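{- Let $\mathbb{F}$ be a field, $\omega:\coprod_{m=1}^{\infty} \mathbb{S}_m \to \mathbb{F}\setminus\{0\}$ any function, and $\mathcal{B} \subset [n]^2$. Then $\rho_{\omega}(M_{\mathcal{B}}(\mathbb{F}))=\nu_b(\mathcal{B})$.
   Context: $[n]=\{1,\dots,n\}$, $\mathbb{S}_m$ is the symmetric group on $[m]$. $M_{\mathcal{B}}(\mathbb{F})=\{A\in M_n(\mathbb{F}): A(i,j)=0 \text{ for } (i,j)\notin\mathcal{B}\}$. A bipartite matching in $\mathcal{B}$ is a subset $\mathcal{B}_0\subset\mathcal{B}$ such that distinct pairs $(i,j)\neq(i',j')$ in $\mathcal{B}_0$ satisfy $i\ne i'$ and $j\ne j'$; $\nu_b(\mathcal{B})$ is the maximum size of one. For $A\in M_m(\mathbb{F})$, $D_\omega(A)=\sum_{\sigma\in\mathbb{S}_m}\omega(\sigma)\prod_{i=1}^m A(i,\sigma(i))$. For $I=\{i_1<\dots<i_k\}$, $J=\{j_1<\dots<j_k\}\subset[n]$, $A[I|J]$ is the $k\times k$ submatrix with $(\alpha,\beta)$ entry $A(i_\alpha,j_\beta)$. $\mathrm{rk}_\omega(A)$ is the largest $k$ such that $D_\omega(A[I|J])\neq0$ for some $k$-element $I,J$ (and $0$ if none), and $\rho_\omega(S)=\max\{\mathrm{rk}_\omega(A):A\in S\}$. -}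

module Defs where

open import Level using (Level; _⊔_; suc)
open import Algebra.Bundles using (CommutativeRing)
open import Data.Nat using (ℕ; zero; _≤_) renaming (suc to sucℕ)
open import Data.Fin using (Fin) renaming (_<_ to _<ᶠ_)
open import Data.Fin.Properties using () renaming (_≟_ to _≟ᶠ_)
open import Data.Vec using (Vec; []; _∷_; lookup; toList)
open import Data.List using (List; []; _∷_; _++_; concatMap; foldr; allFin)
import Data.List.Relation.Unary.Unique.DecPropositional as UniqueDec
open import Data.Bool using (Bool; true; false)
open import Data.Product using (Σ; Σ-syntax; ∃; ∃-syntax; _×_; _,_)
open import Data.Sum using (_⊎_)
open import Relation.Nullary using (¬_; yes; no)
open import Relation.Binary.PropositionalEquality using (_≡_)

private
  variable
    c ℓ : Level

record Field (c ℓ : Level) : Set (Level.suc (c ⊔ ℓ)) where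
  field
    commutativeRing : CommutativeRing c ℓ
  open CommutativeRing commutativeRing public
  field
    1≉0     : ¬ (1# ≈ 0#)
    inverse : ∀ x → ¬ (x ≈ 0#) → Σ[ y ∈ Carrier ] (x * y ≈ 1#)

IsMax : ∀ {p} → (ℕ → Set p) → ℕ → Set p
IsMax P r = (r ≡ 0 ⊎ P r) × (∀ k → P k → k ≤ r)


Perm : ℕ → Set
Perm m = Σ[ v ∈ Vec (Fin m) m ] UniqueDec.Unique (_≟ᶠ_ {m}) (toList v)

apply : ∀ {m} → Perm m → Fin m → Fin m
apply (v , _) i = lookup v i

allVecs : (m k : ℕ) → List (Vec (Fin m) k)
allVecs m zero     = [] ∷ []
allVecs m (sucℕ k) = concatMap (λ x → Data.List.map (x ∷_) (allVecs m k)) (allFin m)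

keepPerms : ∀ {m} → List (Vec (Fin m) m) → List (Perm m)
keepPerms []       = []
keepPerms {m} (v ∷ vs) with UniqueDec.unique? (_≟ᶠ_ {m}) (toList v)
... | yes u = (v , u) ∷ keepPerms vs
... | no  _ = keepPerms vs

allPerms : (m : ℕ) → List (Perm m)
allPerms m = keepPerms (allVecs m m)

module _ (F : Field c ℓ) where
  open Field F

  Matrix : ℕ → ℕ → Set c
  Matrix p q = Fin p → Fin q → Carrier

  prod : ∀ m → (Fin m → Carrier) → Carrier
  prod m f = foldr (λ i acc → f i * acc) 1# (allFin m)

  sumPerms : ∀ m → (Perm m → Carrier) → Carrier
  sumPerms m g = foldr (λ σ acc → g σ + acc) 0# (allPerms m)

  -- ω : ⨆_{m ≥ 1} S_m → F ; ω m σ is the value on σ ∈ S_{m+1}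
  Weight : Set c
  Weight = (m : ℕ) → Perm (sucℕ m) → Carrier

  Dω : Weight → ∀ m → Matrix (sucℕ m) (sucℕ m) → Carrier
  Dω ω m A = sumPerms (sucℕ m) (λ σ → ω m σ * prod (sucℕ m) (λ i → A i (apply σ i)))

  -- k-element subsets of [n], listed increasingly: i₁ < … < i_k
  StrictIncr : ∀ {k n} → (Fin k → Fin n) → Set
  StrictIncr I = ∀ a b → a <ᶠ b → I a <ᶠ I b

  sub : ∀ {n k} → Matrix n n → (Fin k → Fin n) → (Fin k → Fin n) → Matrix k k
  sub A I J α β = A (I α) (J β)

  HasNonzeroMinor : Weight → ∀ {n} → Matrix n n → ℕ → Set ℓ
  HasNonzeroMinor ω A zero     = Level.Lift _ Data.Empty.⊥
    where import Data.Empty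
  HasNonzeroMinor ω {n} A (sucℕ k) =
    Σ[ I ∈ (Fin (sucℕ k) → Fin n) ] Σ[ J ∈ (Fin (sucℕ k) → Fin n) ]
      (StrictIncr I × StrictIncr J × ¬ (Dω ω k (sub A I J) ≈ 0#))

  IsRkω : Weight → ∀ {n} → Matrix n n → ℕ → Set ℓ
  IsRkω ω A = IsMax (HasNonzeroMinor ω A)

  -- M_B(F), with B ⊂ [n]² given by its (decidable) indicator
  InMB : ∀ {n} → (Fin n → Fin n → Bool) → Matrix n n → Set ℓ
  InMB B A = ∀ i j → B i j ≡ false → A i j ≈ 0#

  IsρωMB : Weight → ∀ {n} → (Fin n → Fin n → Bool) → ℕ → Set (c ⊔ ℓ)
  IsρωMB ω B = IsMax (λ k → Σ[ A ∈ Matrix _ _ ] (InMB B A × IsRkω ω A k))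

  NonzeroWeight : Weight → Set ℓ
  NonzeroWeight ω = ∀ m σ → ¬ (ω m σ ≈ 0#)

-- Bipartite matchings: a matching of size k in B is given by listing its
-- k pairs (r a , s a), a ∈ Fin k, with all rows distinct and all columns
-- distinct (so the pairs are distinct and the matching has exactly k elements).

Injective : ∀ {k n} → (Fin k → Fin n) → Set
Injective f = ∀ a b → f a ≡ f b → a ≡ b

HasMatching : ∀ {n} → (Fin n → Fin n → Bool) → ℕ → Set
HasMatching {n} B k =
  Σ[ r ∈ (Fin k → Fin n) ] Σ[ s ∈ (Fin k → Fin n) ]
    (Injective r × Injective s × (∀ a → B (r a) (s a) ≡ true))

IsNuB : ∀ {n} → (Fin n → Fin n → Bool) → ℕ → Set
IsNuB B = IsMax (HasMatching B)

module Submission where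

-- A term of D_ω(A[I|J]) for A ∈ M_B(F) can be nonzero only if the positions (I α, J (σ α))
-- of its factors all lie in B, and these form a matching; so rk_ω(A) ≤ ν_b(B).  Conversely,
-- the 0/1 matrix of a matching of size k has, on the rows and columns the matching uses, a
-- minor that is a permutation matrix; only one permutation contributes to its D_ω, which is
-- therefore a single nonzero value of ω.

open import Defs
open import Level using (Level)
open import Algebra.Bundles using (Semiring)
open import Data.Nat using (ℕ; zero; suc; z≤n; s≤s; s≤s⁻¹) renaming (_≤_ to _≤ℕ_)
open import Data.Nat.Properties using (≤∧≢⇒<)
open import Data.Fin using (Fin; _<_; punchIn; punchOut; finToFun; funToFin)
open import Data.Fin.Properties
  using (any?; all?; ¬∀⟶∃¬; ¬Fin0; <-cmp; <⇒≢; injective⇒≤; finToFun-funToFin;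
         punchInᵢ≢i; punchIn-punchOut; punchIn-injective; punchOut-injective; suc-injective)
  renaming (_≟_ to _≟ᶠ_)
open import Data.Bool using (Bool; true)
open import Data.Bool.Properties using (¬-not) renaming (_≟_ to _≟ᵇ_)
open import Data.Product using (Σ-syntax; ∃; _×_; _,_; proj₁)
open import Data.Sum using (_⊎_; inj₁; inj₂)
open import Data.Empty using (⊥-elim)
open import Data.List using (List; []; _∷_; _++_; concatMap; foldr; tabulate; allFin)
import Data.List as List
open import Data.List.Membership.Propositional using (_∈_)
open import Data.List.Membership.Propositional.Properties using (∈-allFin)
open import Data.List.Relation.Unary.Any using (here; there)
open import Data.List.Relation.Unary.AllPairs using ([]; _∷_)
import Data.List.Relation.Unary.Unique.Propositional as ListUnique
import Data.List.Relation.Unary.Unique.DecPropositional as UniqueDec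
open import Data.Vec using (Vec; []; _∷_; lookup; toList)
import Data.Vec as Vec
open import Data.Vec.Properties using (tabulate∘lookup; tabulate-cong; lookup∘tabulate; ∷-injectiveˡ; ∷-injectiveʳ)
open import Data.Vec.Relation.Unary.All.Properties using (toList⁺; toList⁻)
open import Data.Vec.Relation.Unary.AllPairs using ([]; _∷_)
import Data.Vec.Relation.Unary.Unique.Propositional as VecUnique
import Data.Vec.Relation.Unary.Unique.Propositional.Properties as VecUnique
open import Function using (_∘_; id)
open import Relation.Binary.Core using (_Preserves_⟶_)
open import Relation.Binary.Definitions using (tri<; tri≈; tri>)
open import Relation.Binary.PropositionalEquality
  using (_≡_; _≢_; _≗_; refl; sym; trans; cong; subst; subst₂)
open import Relation.Nullary using (¬_; Dec; yes; no; contradiction)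
open import Relation.Nullary.Decidable using (map′; _×-dec_; _→-dec_)

private
  variable
    k m n : ℕ

∃IsMax : ∀ {p} {P : ℕ → Set p} → (∀ k → Dec (P k)) →
         ∀ m → (∀ k → P k → k ≤ℕ m) → ∃ (IsMax P)
∃IsMax P? zero    bounded = 0 , inj₁ refl , bounded
∃IsMax {P = P} P? (suc m) bounded with P? (suc m)
... | yes p = suc m , inj₂ p , bounded
... | no ¬p = ∃IsMax P? m (λ k pk → s≤s⁻¹ (≤∧≢⇒< (bounded k pk) (λ k≡1+m → ¬p (subst P k≡1+m pk))))

-- Functions Fin m → Fin n are enumerated by Fin (n ^ m).
∃-fun? : ∀ {p} {P : (Fin m → Fin n) → Set p} → (∀ {f g} → f ≗ g → P f → P g) →
         (∀ f → Dec (P f)) → Dec (∃ P)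
∃-fun? resp P? =
  map′ (λ (i , p) → finToFun i , p)
       (λ (f , p) → funToFin f , resp (sym ∘ finToFun-funToFin f) p)
       (any? (P? ∘ finToFun))

injective? : (f : Fin k → Fin n) → Dec (Injective f)
injective? f = all? λ a → all? λ b → (f a ≟ᶠ f b) →-dec (a ≟ᶠ b)

increasing⇒injective : {f : Fin k → Fin n} → f Preserves _<_ ⟶ _<_ → Injective f
increasing⇒injective {f = f} increasing a b fa≡fb with <-cmp a b
... | tri< a<b _ _ = contradiction fa≡fb (<⇒≢ (increasing a<b))
... | tri≈ _ a≡b _ = a≡b
... | tri> _ _ b<a = contradiction (sym fa≡fb) (<⇒≢ (increasing b<a))

≢tabulate⇒∃lookup≢ : (v : Vec (Fin n) k) (τ : Fin k → Fin n) →
                     v ≢ Vec.tabulate τ → ∃ λ i → lookup v i ≢ τ i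
≢tabulate⇒∃lookup≢ {k = k} v τ v≢τ =
  ¬∀⟶∃¬ k _ (λ i → lookup v i ≟ᶠ τ i)
    (λ v≗τ → v≢τ (trans (sym (tabulate∘lookup v)) (tabulate-cong v≗τ)))

IsMatching : (B : Fin n → Fin n → Bool) (r s : Fin k → Fin n) → Set
IsMatching B r s = Injective r × Injective s × (∀ a → B (r a) (s a) ≡ true)

isMatching? : (B : Fin n → Fin n → Bool) (r s : Fin k → Fin n) → Dec (IsMatching B r s)
isMatching? B r s = injective? r ×-dec injective? s ×-dec all? (λ a → B (r a) (s a) ≟ᵇ true)

isMatching-resp : (B : Fin n → Fin n → Bool) {r r′ s s′ : Fin k → Fin n} → r ≗ r′ → s ≗ s′ →
                  IsMatching B r s → IsMatching B r′ s′
isMatching-resp B r≗r′ s≗s′ (r-inj , s-inj , r∼s) =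
  (λ a b e → r-inj a b (trans (r≗r′ a) (trans e (sym (r≗r′ b))))) ,
  (λ a b e → s-inj a b (trans (s≗s′ a) (trans e (sym (s≗s′ b))))) ,
  (λ a → subst₂ (λ i j → B i j ≡ true) (r≗r′ a) (s≗s′ a) (r∼s a))

matching? : (B : Fin n → Fin n → Bool) → ∀ k → Dec (HasMatching B k)
matching? B k =
  ∃-fun? (λ r≗r′ (s , m) → s , isMatching-resp B r≗r′ (λ _ → refl) m) λ r →
  ∃-fun? (isMatching-resp B (λ _ → refl)) λ s →
  isMatching? B r s

inMatching? : (r s : Fin k → Fin n) (i j : Fin n) → Dec (∃ λ a → r a ≡ i × s a ≡ j)
inMatching? r s i j = any? λ a → (r a ≟ᶠ i) ×-dec (s a ≟ᶠ j)

matching-size≤ : (B : Fin n → Fin n → Bool) → HasMatching B k → k ≤ℕ n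
matching-size≤ B (r , _ , r-inj , _) = injective⇒≤ (λ {a} {b} → r-inj a b)

record Sorting (r : Fin k → Fin n) : Set where
  field
    sorted      : Fin k → Fin n
    increasing  : sorted Preserves _<_ ⟶ _<_
    index       : Fin k → Fin k
    r∘index     : ∀ α → r (index α) ≡ sorted α
    rank        : Fin k → Fin k
    sorted∘rank : ∀ a → sorted (rank a) ≡ r a

sorting-shift : (r : Fin k → Fin (suc n)) (0≢r : ∀ a → Fin.zero ≢ r a) →
                Sorting (λ a → punchOut (0≢r a)) → Sorting r
sorting-shift r 0≢r s = record
  { sorted = Fin.suc ∘ sorted ; increasing = s≤s ∘ increasing ; index = index
  ; r∘index = λ α → trans (sym (punchIn-punchOut (0≢r (index α)))) (cong Fin.suc (r∘index α))
  ; rank = rank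
  ; sorted∘rank = λ a → trans (cong Fin.suc (sorted∘rank a)) (punchIn-punchOut (0≢r a)) }
  where open Sorting s

sorting-cons : (r : Fin (suc k) → Fin (suc n)) (a₀ : Fin (suc k)) → Fin.zero ≡ r a₀ →
               (0≢r : ∀ b → Fin.zero ≢ r (punchIn a₀ b)) →
               Sorting (λ b → punchOut (0≢r b)) → Sorting r
sorting-cons {k} {n} r a₀ 0≡ra₀ 0≢r s = record
  { sorted = sorted′ ; increasing = increasing′ ; index = index′ ; r∘index = r∘index′
  ; rank = rank′ ; sorted∘rank = sorted∘rank′ }
  where
  open Sorting s
  sorted′ : Fin (suc k) → Fin (suc n)
  sorted′ Fin.zero    = Fin.zero
  sorted′ (Fin.suc β) = Fin.suc (sorted β)
  increasing′ : sorted′ Preserves _<_ ⟶ _<_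
  increasing′ {Fin.zero}  {Fin.suc _} _         = s≤s z≤n
  increasing′ {Fin.suc _} {Fin.suc _} (s≤s α<β) = s≤s (increasing α<β)
  index′ : Fin (suc k) → Fin (suc k)
  index′ Fin.zero    = a₀
  index′ (Fin.suc β) = punchIn a₀ (index β)
  r∘index′ : ∀ α → r (index′ α) ≡ sorted′ α
  r∘index′ Fin.zero    = sym 0≡ra₀
  r∘index′ (Fin.suc β) = trans (sym (punchIn-punchOut (0≢r (index β)))) (cong Fin.suc (r∘index β))
  rank′ : Fin (suc k) → Fin (suc k)
  rank′ a with a₀ ≟ᶠ a
  ... | yes _   = Fin.zero
  ... | no a₀≢a = Fin.suc (rank (punchOut a₀≢a))
  sorted∘rank′ : ∀ a → sorted′ (rank′ a) ≡ r a
  sorted∘rank′ a with a₀ ≟ᶠ a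
  ... | yes refl = 0≡ra₀
  ... | no a₀≢a  = trans (cong Fin.suc (sorted∘rank b))
                         (trans (punchIn-punchOut (0≢r b)) (cong r (punchIn-punchOut a₀≢a)))
    where b = punchOut a₀≢a

-- Recursion on n: according to whether 0 is a value of r, the remaining values,
-- moved down by one, are sorted and then shifted up (and preceded by 0).
sort : (r : Fin k → Fin n) → Injective r → Sorting r
sort {zero} r _ = record
  { sorted = r ; increasing = λ {a} → ⊥-elim (¬Fin0 a)
  ; index = id ; r∘index = λ _ → refl ; rank = id ; sorted∘rank = λ _ → refl }
sort {suc k} {zero} r _ = ⊥-elim (¬Fin0 (r Fin.zero))
sort {suc k} {suc n} r r-inj with any? (λ a → Fin.zero ≟ᶠ r a)
... | no 0∉r = sorting-shift r 0≢r (sort _ λ a b → r-inj a b ∘ punchOut-injective (0≢r a) (0≢r b))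
  where
  0≢r : ∀ a → Fin.zero ≢ r a
  0≢r a 0≡ra = 0∉r (a , 0≡ra)
... | yes (a₀ , 0≡ra₀) = sorting-cons r a₀ 0≡ra₀ 0≢r
      (sort _ λ b c → punchIn-injective a₀ b c ∘ r-inj _ _ ∘ punchOut-injective (0≢r b) (0≢r c))
  where
  0≢r : ∀ b → Fin.zero ≢ r (punchIn a₀ b)
  0≢r b 0≡rb = punchInᵢ≢i a₀ b (r-inj _ _ (trans (sym 0≡rb) 0≡ra₀))

unique-toList⁻ : {v : Vec (Fin n) k} → ListUnique.Unique (toList v) → VecUnique.Unique v
unique-toList⁻ {v = []}    []        = []
unique-toList⁻ {v = _ ∷ _} (x∉ ∷ xs) = toList⁻ x∉ ∷ unique-toList⁻ xs

unique-toList⁺ : {v : Vec (Fin n) k} → VecUnique.Unique v → ListUnique.Unique (toList v)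
unique-toList⁺ []        = []
unique-toList⁺ (x∉ ∷ xs) = toList⁺ x∉ ∷ unique-toList⁺ xs

apply-injective : (σ : Perm m) → Injective (apply σ)
apply-injective (_ , unique) = VecUnique.lookup-injective (unique-toList⁻ unique)

fromInjection : (τ : Fin m → Fin m) → Injective τ → Perm m
fromInjection τ τ-inj = Vec.tabulate τ , unique-toList⁺ (VecUnique.tabulate⁺ λ {a} {b} → τ-inj a b)

module ListSum {c ℓ} (R : Semiring c ℓ) where
  open Semiring R renaming (refl to ≈-refl; sym to ≈-sym; trans to ≈-trans)
  open import Relation.Binary.Reasoning.Setoid setoid

  sumBy : {A : Set} → (A → Carrier) → List A → Carrier
  sumBy f = foldr (λ x acc → f x + acc) 0#

  prodBy : {A : Set} → (A → Carrier) → List A → Carrier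
  prodBy f = foldr (λ x acc → f x * acc) 1#

  module _ {A : Set} where

    sumBy-≈0 : (f : A → Carrier) (xs : List A) → (∀ x → f x ≈ 0#) → sumBy f xs ≈ 0#
    sumBy-≈0 f []       f≈0 = ≈-refl
    sumBy-≈0 f (x ∷ xs) f≈0 = ≈-trans (+-cong (f≈0 x) (sumBy-≈0 f xs f≈0)) (+-identityˡ 0#)

    sumBy-++ : (f : A → Carrier) (xs ys : List A) → sumBy f (xs ++ ys) ≈ sumBy f xs + sumBy f ys
    sumBy-++ f []       ys = ≈-sym (+-identityˡ _)
    sumBy-++ f (x ∷ xs) ys = ≈-trans (+-congˡ (sumBy-++ f xs ys)) (≈-sym (+-assoc _ _ _))

    sumBy-tabulate-≈0 : (f : A → Carrier) (g : Fin n → A) → (∀ y → f (g y) ≈ 0#) → sumBy f (tabulate g) ≈ 0#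
    sumBy-tabulate-≈0 {zero}  f g f∘g≈0 = ≈-refl
    sumBy-tabulate-≈0 {suc n} f g f∘g≈0 =
      ≈-trans (+-cong (f∘g≈0 Fin.zero) (sumBy-tabulate-≈0 f (g ∘ Fin.suc) (f∘g≈0 ∘ Fin.suc))) (+-identityˡ 0#)

    sumBy-tabulate-single : (f : A → Carrier) (g : Fin n → A) (x : Fin n) →
                            (∀ y → y ≢ x → f (g y) ≈ 0#) → sumBy f (tabulate g) ≈ f (g x)
    sumBy-tabulate-single {suc n} f g Fin.zero f∘g≈0 = begin
      f (g Fin.zero) + sumBy f (tabulate (g ∘ Fin.suc))
        ≈⟨ +-congˡ (sumBy-tabulate-≈0 f (g ∘ Fin.suc) λ y → f∘g≈0 (Fin.suc y) λ ()) ⟩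
      f (g Fin.zero) + 0#
        ≈⟨ +-identityʳ _ ⟩
      f (g Fin.zero)
        ∎
    sumBy-tabulate-single {suc n} f g (Fin.suc x) f∘g≈0 = begin
      f (g Fin.zero) + sumBy f (tabulate (g ∘ Fin.suc))
        ≈⟨ +-cong (f∘g≈0 Fin.zero λ ())
                  (sumBy-tabulate-single f (g ∘ Fin.suc) x λ y y≢x → f∘g≈0 (Fin.suc y) (y≢x ∘ suc-injective)) ⟩
      0# + f (g (Fin.suc x))
        ≈⟨ +-identityˡ _ ⟩
      f (g (Fin.suc x))
        ∎

    prodBy-≈1 : (f : A → Carrier) (xs : List A) → (∀ x → f x ≈ 1#) → prodBy f xs ≈ 1#
    prodBy-≈1 f []       f≈1 = ≈-refl
    prodBy-≈1 f (x ∷ xs) f≈1 = ≈-trans (*-cong (f≈1 x) (prodBy-≈1 f xs f≈1)) (*-identityˡ 1#)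

    prodBy-≈0 : (f : A → Carrier) {xs : List A} {x : A} → x ∈ xs → f x ≈ 0# → prodBy f xs ≈ 0#
    prodBy-≈0 f (here refl) fx≈0 = ≈-trans (*-congʳ fx≈0) (zeroˡ _)
    prodBy-≈0 f (there x∈)  fx≈0 = ≈-trans (*-congˡ (prodBy-≈0 f x∈ fx≈0)) (zeroʳ _)

  sumBy-concatMap : {A B : Set} (f : B → Carrier) (g : A → List B) (xs : List A) →
                    sumBy f (concatMap g xs) ≈ sumBy (sumBy f ∘ g) xs
  sumBy-concatMap f g []       = ≈-refl
  sumBy-concatMap f g (x ∷ xs) = ≈-trans (sumBy-++ f (g x) (concatMap g xs)) (+-congˡ (sumBy-concatMap f g xs))

  sumBy-map : {A B : Set} (f : B → Carrier) (g : A → B) (xs : List A) →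
              sumBy f (List.map g xs) ≡ sumBy (f ∘ g) xs
  sumBy-map f g []       = refl
  sumBy-map f g (x ∷ xs) = cong (f (g x) +_) (sumBy-map f g xs)

  sumBy-allVecs-single : ∀ k (h : Vec (Fin m) k → Carrier) (v : Vec (Fin m) k) →
                         (∀ w → w ≢ v → h w ≈ 0#) → sumBy h (allVecs m k) ≈ h v
  sumBy-allVecs-single zero    h []      h≈0 = +-identityʳ (h [])
  sumBy-allVecs-single {m} (suc k) h (x ∷ v) h≈0 = begin
    sumBy h (allVecs m (suc k))              ≈⟨ sumBy-concatMap h row (allFin m) ⟩
    sumBy (λ y → sumBy h (row y)) (allFin m) ≈⟨ sumBy-tabulate-single _ id x other-rows≈0 ⟩
    sumBy h (row x)                          ≡⟨ sumBy-map h (x ∷_) (allVecs m k) ⟩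
    sumBy (h ∘ (x ∷_)) (allVecs m k)         ≈⟨ sumBy-allVecs-single k (h ∘ (x ∷_)) v (λ w w≢v → h≈0 (x ∷ w) (w≢v ∘ ∷-injectiveʳ)) ⟩
    h (x ∷ v)                                ∎
    where
    row : Fin m → List (Vec (Fin m) (suc k))
    row y = List.map (y ∷_) (allVecs m k)
    other-rows≈0 : ∀ y → y ≢ x → sumBy h (row y) ≈ 0#
    other-rows≈0 y y≢x = ≈-trans (reflexive (sumBy-map h (y ∷_) (allVecs m k)))
                                 (sumBy-≈0 (h ∘ (y ∷_)) (allVecs m k) (λ w → h≈0 (y ∷ w) (y≢x ∘ ∷-injectiveˡ)))

  extendPerm : (Perm m → Carrier) → Vec (Fin m) m → Carrier
  extendPerm {m} g v with UniqueDec.unique? (_≟ᶠ_ {m}) (toList v)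
  ... | yes unique = g (v , unique)
  ... | no  _      = 0#

  sumBy-keepPerms : (g : Perm m → Carrier) (vs : List (Vec (Fin m) m)) →
                    sumBy g (keepPerms vs) ≈ sumBy (extendPerm g) vs
  sumBy-keepPerms g [] = ≈-refl
  sumBy-keepPerms {m} g (v ∷ vs) with UniqueDec.unique? (_≟ᶠ_ {m}) (toList v)
  ... | yes _ = +-congˡ (sumBy-keepPerms g vs)
  ... | no  _ = ≈-trans (sumBy-keepPerms g vs) (≈-sym (+-identityˡ _))

  -- g may depend on the uniqueness proof inside a permutation, so only the underlying
  -- vector of the surviving term is determined.
  extendPerm-perm : (g : Perm m → Carrier) (σ₀ : Perm m) →
                    ∃ λ σ → proj₁ σ ≡ proj₁ σ₀ × extendPerm g (proj₁ σ₀) ≈ g σ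
  extendPerm-perm {m} g (v , unique) with UniqueDec.unique? (_≟ᶠ_ {m}) (toList v)
  ... | yes unique′ = (v , unique′) , refl , ≈-refl
  ... | no  ¬unique = contradiction unique ¬unique

  sumBy-allPerms-single : (g : Perm m → Carrier) (σ₀ : Perm m) →
                          (∀ σ → proj₁ σ ≢ proj₁ σ₀ → g σ ≈ 0#) →
                          ∃ λ σ → proj₁ σ ≡ proj₁ σ₀ × sumBy g (allPerms m) ≈ g σ
  sumBy-allPerms-single {m} g σ₀ g≈0 =
    let σ , σ≡σ₀ , extend≈g = extendPerm-perm g σ₀ in
    σ , σ≡σ₀ , (begin
      sumBy g (allPerms m)               ≈⟨ sumBy-keepPerms g (allVecs m m) ⟩
      sumBy (extendPerm g) (allVecs m m) ≈⟨ sumBy-allVecs-single m (extendPerm g) (proj₁ σ₀) others≈0 ⟩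
      extendPerm g (proj₁ σ₀)            ≈⟨ extend≈g ⟩
      g σ                                ∎)
    where
    others≈0 : ∀ w → w ≢ proj₁ σ₀ → extendPerm g w ≈ 0#
    others≈0 w w≢σ₀ with UniqueDec.unique? (_≟ᶠ_ {m}) (toList w)
    ... | yes unique = g≈0 (w , unique) w≢σ₀
    ... | no  _      = ≈-refl

module _ {c ℓ} (F : Field c ℓ) (ω : Weight F) where
  open Field F renaming (refl to ≈-refl; sym to ≈-sym; trans to ≈-trans)
  open ListSum semiring
  open import Relation.Binary.Reasoning.Setoid setoid

  Dω-permutationMatrix : ∀ k (M : Matrix F (suc k) (suc k)) (τ : Fin (suc k) → Fin (suc k)) → Injective τ →
                         (∀ α → M α (τ α) ≈ 1#) → (∀ α β → β ≢ τ α → M α β ≈ 0#) →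
                         ∃ λ σ → Dω F ω k M ≈ ω k σ
  Dω-permutationMatrix k M τ τ-inj M≈1 M≈0 =
    let σ , σ≡τ , Dω≈ = sumBy-allPerms-single term (fromInjection τ τ-inj) other-terms≈0 in
    σ , (begin
      Dω F ω k M                          ≈⟨ Dω≈ ⟩
      ω k σ * prodBy (entry σ) (allFin K) ≈⟨ *-congˡ (prodBy-≈1 (entry σ) (allFin K) (entry≈1 σ σ≡τ)) ⟩
      ω k σ * 1#                          ≈⟨ *-identityʳ _ ⟩
      ω k σ                               ∎)
    where
    K = suc k
    entry : Perm K → Fin K → Carrier
    entry σ i = M i (apply σ i)
    term : Perm K → Carrier
    term σ = ω k σ * prodBy (entry σ) (allFin K)
    entry≈1 : ∀ σ → proj₁ σ ≡ Vec.tabulate τ → ∀ i → entry σ i ≈ 1#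
    entry≈1 σ σ≡τ i = subst (λ j → M i j ≈ 1#)
      (sym (trans (cong (λ v → lookup v i) σ≡τ) (lookup∘tabulate τ i))) (M≈1 i)
    other-terms≈0 : ∀ σ → proj₁ σ ≢ Vec.tabulate τ → term σ ≈ 0#
    other-terms≈0 σ σ≢τ =
      let i , σi≢τi = ≢tabulate⇒∃lookup≢ (proj₁ σ) τ σ≢τ in
      ≈-trans (*-congˡ (prodBy-≈0 (entry σ) (∈-allFin i) (M≈0 i _ σi≢τi))) (zeroʳ _)

  nonzeroMinor⇒matching : {B : Fin n → Fin n → Bool} {A : Matrix F n n} → InMB F B A →
                          HasNonzeroMinor F ω A k → HasMatching B k
  nonzeroMinor⇒matching {k = zero} _ ()
  nonzeroMinor⇒matching {k = suc k} {B} {A} A∈MB (I , J , I-incr , J-incr , Dω≉0)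
    with matching? B (suc k)
  ... | yes matching = matching
  ... | no ¬matching = contradiction (sumBy-≈0 _ (allPerms (suc k)) term≈0) Dω≉0
    where
    term≈0 : ∀ σ → ω k σ * prodBy (λ i → A (I i) (J (apply σ i))) (allFin (suc k)) ≈ 0#
    term≈0 σ with all? (λ i → B (I i) (J (apply σ i)) ≟ᵇ true)
    ... | yes in-B = contradiction
            (I , J ∘ apply σ , increasing⇒injective (I-incr _ _) ,
             (λ a b → apply-injective σ a b ∘ increasing⇒injective (J-incr _ _) _ _) , in-B)
            ¬matching
    ... | no ¬in-B =
      let i , ∉B = ¬∀⟶∃¬ (suc k) _ (λ i → B (I i) (J (apply σ i)) ≟ᵇ true) ¬in-B in
      ≈-trans (*-congˡ (prodBy-≈0 _ (∈-allFin i) (A∈MB _ _ (¬-not ∉B)))) (zeroʳ _)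

  indicator : ∀ {p} {X : Set p} → Dec X → Carrier
  indicator (yes _) = 1#
  indicator (no _)  = 0#

  indicator-yes : ∀ {p} {X : Set p} (d : Dec X) → X → indicator d ≈ 1#
  indicator-yes (yes _) _ = ≈-refl
  indicator-yes (no ¬x) x = contradiction x ¬x

  indicator-no : ∀ {p} {X : Set p} (d : Dec X) → ¬ X → indicator d ≈ 0#
  indicator-no (yes x) ¬x = contradiction x ¬x
  indicator-no (no _)  _  = ≈-refl

  matchingMatrix : (r s : Fin k → Fin n) → Matrix F n n
  matchingMatrix r s i j = indicator (inMatching? r s i j)

  matchingMatrix∈MB : (B : Fin n → Fin n → Bool) {r s : Fin k → Fin n} →
                      IsMatching B r s → InMB F B (matchingMatrix r s)
  matchingMatrix∈MB B {r} {s} (_ , _ , r∼s) i j ij∉B = indicator-no (inMatching? r s i j) λ where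
    (a , refl , refl) → contradiction (trans (sym (r∼s a)) ij∉B) λ ()

  matching⇒nonzeroMinor : NonzeroWeight F ω → (B : Fin n → Fin n → Bool) → HasMatching B (suc k) →
                          Σ[ A ∈ Matrix F n n ] (InMB F B A × HasNonzeroMinor F ω A (suc k))
  matching⇒nonzeroMinor {k = k} ω≉0 B (r , s , isMatching@(r-inj , s-inj , _)) =
    A , matchingMatrix∈MB B isMatching ,
    sorted rows , sorted cols , (λ _ _ → increasing rows) , (λ _ _ → increasing cols) ,
    λ Dω≈0 → let σ , Dω≈ω = Dω-permutationMatrix k minor τ τ-inj diagonal≈1 off-diagonal≈0
             in ω≉0 k σ (≈-trans (≈-sym Dω≈ω) Dω≈0)
    where
    open Sorting
    A = matchingMatrix r s
    rows = sort r r-inj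
    cols = sort s s-inj
    minor = sub F A (sorted rows) (sorted cols)
    -- the matching edge in row α of the minor lies in column τ α
    τ : Fin (suc k) → Fin (suc k)
    τ = rank cols ∘ index rows
    edge : ∀ α → sorted cols (τ α) ≡ s (index rows α)
    edge α = sorted∘rank cols (index rows α)
    diagonal≈1 : ∀ α → minor α (τ α) ≈ 1#
    diagonal≈1 α = indicator-yes (inMatching? r s _ _) (index rows α , r∘index rows α , sym (edge α))
    off-diagonal≈0 : ∀ α β → β ≢ τ α → minor α β ≈ 0#
    off-diagonal≈0 α β β≢τα = indicator-no (inMatching? r s _ _) λ (a , ra≡ , sa≡) →
      β≢τα (increasing⇒injective (increasing cols) β (τ α)
        (trans (sym sa≡) (trans (cong s (r-inj a _ (trans ra≡ (sym (r∘index rows α))))) (sym (edge α)))))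
    τ-inj : Injective τ
    τ-inj α α′ τα≡τα′ = increasing⇒injective (increasing rows) α α′
      (trans (sym (r∘index rows α))
        (trans (cong r (s-inj _ _ (trans (sym (edge α)) (trans (cong (sorted cols) τα≡τα′) (edge α′)))))
               (r∘index rows α′)))

  rank≤ν : {B : Fin n → Fin n → Bool} {A : Matrix F n n} {ν : ℕ} →
           IsNuB B ν → InMB F B A → IsRkω F ω A k → k ≤ℕ ν
  rank≤ν _             _    (inj₁ refl  , _) = z≤n
  rank≤ν (_ , maximal) A∈MB (inj₂ minor , _) = maximal _ (nonzeroMinor⇒matching A∈MB minor)

  ν-attained : NonzeroWeight F ω → {B : Fin n → Fin n → Bool} {ν : ℕ} → IsNuB B ν →
               ν ≡ 0 ⊎ Σ[ A ∈ Matrix F n n ] (InMB F B A × IsRkω F ω A ν)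
  ν-attained ω≉0 {ν = zero}  _                        = inj₁ refl
  ν-attained ω≉0 {B} {suc k} (inj₂ matching , maximal) =
    let A , A∈MB , minor = matching⇒nonzeroMinor ω≉0 B matching in
    inj₂ (A , A∈MB , inj₂ minor , λ k′ minor′ → maximal k′ (nonzeroMinor⇒matching A∈MB minor′))

claim2p1 : ∀ {c ℓ : Level} (F : Field c ℓ) (ω : Weight F) → NonzeroWeight F ω →
           ∀ (n : ℕ) (B : Fin n → Fin n → Bool) →
           ∃ (λ r → IsρωMB F ω B r × IsNuB B r)
claim2p1 F ω ω≉0 n B =
  let ν , isNuB = ∃IsMax (matching? B) n (λ _ → matching-size≤ B) in
  ν , (ν-attained F ω ω≉0 isNuB , λ k (A , A∈MB , isRk) → rank≤ν F ω isNuB A∈MB isRk) , isNuB
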